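{- Let $k\ge 1$ and let $\mathcal{M}_k$ and its $k$-boxes $\mathcal{B}_1,\dots,\mathcal{B}_k$ be as defined in the context. Let $\mathcal{I}\subseteq \mathcal{M}_k$ be a set of pairwise disjoint segments. Then for every $i\in\{1,\dots,k\}$, $|\mathcal{B}_i\cap\mathcal{I}|\le 2k$. Moreover, if $\mathcal{B}_i$ is boring for $\mathcal{I}$, then $|\mathcal{B}_i\cap\mathcal{I}|\le k+1$.
   Context: Fix an integer $k\ge1$ and let $N=2k(k+1)+1$; all segments below are closed. For $i,j\in\{1,\dots,k\}$ define: the vertical line $x=2ki+2j-1$ with meeting point $p_{i,j}=(2ki+2j-1,\,2ki-2j+1)$, carrying the up segment $\{2ki+2j-1\}\times[2ki-2j+1,N]$ and the down segment $\{2ki+2j-1\}\times[-1,2ki-2j+1]$; and the horizontal line $y=2ki-2j$ with meeting point $q_{i,j}=(2ki+2j,\,2ki-2j)$, carrying the right segment $[2ki+2j,N]\times\{2ki-2j\}$ and the left segment $[-1,2ki+2j]\times\{2ki-2j\}$. The $k$-box $\mathcal{B}_i$ is the set of the $4k$ segments (up, down, right and left segments) with index $i$ and $j=1,\dots,k$; $\mathcal{M}_k=\bigcup_{i=1}^k\mathcal{B}_i$ has $4k^2$ segments. (Thus within each box the meeting points lie along a top-left to bottom-right diagonal, the boxes are placed along a bottom-left to top-right diagonal of the square $[-1,N]^2$, and every segment extends from its meeting point to the boundary of this square.) Given a set $\mathcal{I}$ of pairwise disjoint segments of $\mathcal{M}_k$, a box $\mathcal{B}_i$ is interesting for $\mathcal{I}$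 if $\mathcal{B}_i\cap\mathcal{I}$ contains at least one down segment and at least one right segment, or contains at least one up segment and at least one left segment; otherwise $\mathcal{B}_i$ is boring for $\mathcal{I}$. -}

module Defs where

open import Data.Nat using (ℕ; suc)
open import Data.Fin using (Fin; toℕ)
open import Data.Integer as Z using (ℤ; +_; -[1+_])
open import Data.Rational as Q using (ℚ; _/_)
open import Data.Bool using (Bool; true; false; if_then_else_)
open import Data.List using (List; _∷_; []; map; allFin)
open import Data.Nat.ListAction using (sum)
open import Data.Product using (_×_; _,_; ∃-syntax; Σ-syntax)
open import Data.Sum using (_⊎_)
open import Relation.Nullary using (¬_)
open import Relation.Binary.PropositionalEquality using (_≡_; _≢_)

data Kind : Set where
  up down right left : Kind

-- A segment of M_k is labelled by its kind, its box index i and its index j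
-- (both in {1,…,k}, represented as Fin k with value toℕ + 1).
Label : ℕ → Set
Label k = Kind × Fin k × Fin k

-- An axis-parallel closed segment given by its bounding box [x₁,x₂]×[y₁,y₂]
-- (one of the two intervals is degenerate).
record Seg : Set where
  constructor seg
  field
    x₁ x₂ y₁ y₂ : ℤ

Point : Set
Point = ℚ × ℚ

toℚ : ℤ → ℚ
toℚ z = z / 1

_∈ˢ_ : Point → Seg → Set
(px , py) ∈ˢ seg x₁ x₂ y₁ y₂ =
  (toℚ x₁ Q.≤ px × px Q.≤ toℚ x₂) × (toℚ y₁ Q.≤ py × py Q.≤ toℚ y₂)

Disjoint : Seg → Seg → Set
Disjoint s t = ¬ (Σ[ p ∈ Point ] (p ∈ˢ s × p ∈ˢ t))

idx : ∀ {k} → Fin k → ℤ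
idx i = + suc (toℕ i)

bigN : ℕ → ℤ
bigN k = + (2 ℕ.* k ℕ.* (k ℕ.+ 1) ℕ.+ 1)
  where import Data.Nat as ℕ

segment : (k : ℕ) → Label k → Seg
segment k (up , i , j) = seg vx vx vy (bigN k)
  where open Z
        vx = + 2 * + k * idx i + + 2 * idx j - + 1
        vy = + 2 * + k * idx i - + 2 * idx j + + 1
segment k (down , i , j) = seg vx vx (-[1+ 0 ]) vy
  where open Z
        vx = + 2 * + k * idx i + + 2 * idx j - + 1
        vy = + 2 * + k * idx i - + 2 * idx j + + 1
segment k (right , i , j) = seg hx (bigN k) hy hy
  where open Z
        hx = + 2 * + k * idx i + + 2 * idx j
        hy = + 2 * + k * idx i - + 2 * idx j
segment k (left , i , j) = seg (-[1+ 0 ]) hx hy hy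
  where open Z
        hx = + 2 * + k * idx i + + 2 * idx j
        hy = + 2 * + k * idx i - + 2 * idx j

SubsetM : ℕ → Set
SubsetM k = Label k → Bool

PairwiseDisjoint : (k : ℕ) → SubsetM k → Set
PairwiseDisjoint k I = ∀ (l l' : Label k) → I l ≡ true → I l' ≡ true → l ≢ l' →
  Disjoint (segment k l) (segment k l')

boxCount : (k : ℕ) → SubsetM k → Fin k → ℕ
boxCount k I i = sum (map (λ κ → sum (map (λ j → if I (κ , i , j) then 1 else 0) (allFin k)))
                          (up ∷ down ∷ right ∷ left ∷ []))

HasKind : (k : ℕ) → SubsetM k → Fin k → Kind → Set
HasKind k I i κ = ∃[ j ] (I (κ , i , j) ≡ true)

Interesting : (k : ℕ) → SubsetM k → Fin k → Set
Interesting k I i = (HasKind k I i down × HasKind k I i right)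
                  ⊎ (HasKind k I i up × HasKind k I i left)

Boring : (k : ℕ) → SubsetM k → Fin k → Set
Boring k I i = ¬ Interesting k I i

{-# OPTIONS --safe #-}
module Submission where

-- Within one box, the up and down segments of index j meet at p_j, the right and left ones at
-- q_j, the down and left ones at the corner (x(p_j), y(q_j)), and the up segment of index u
-- meets the right segment of index v whenever v < u.  Hence, writing U, D, R, L for the numbers
-- of chosen segments of each kind, U + D ≤ k, R + L ≤ k, D + L ≤ k and U + R ≤ k + 1 (every
-- chosen up index is at most every chosen right index, so the two index sets share at most one
-- element).  A boring box has D = 0 or R = 0, and U = 0 or L = 0, so the two surviving kinds
-- always form one of these four pairs.

open import Defs
open import Data.Bool using (Bool; true; false; if_then_else_)
open import Data.Empty using (⊥; ⊥-elim)
open import Data.Fin using (Fin; zero; suc; toℕ) renaming (_<_ to _<ᶠ_)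
open import Data.Fin.Properties using (toℕ<n)
open import Data.Integer using (ℤ; +_; -[1+_]; +≤+; -≤+)
import Data.Integer.Properties as ℤ
open import Data.List using (_∷_; []; map; tabulate)
open import Data.List.Properties using (map-cong; map-tabulate)
open import Data.Nat using (ℕ; zero; suc)
import Data.Nat as ℕ
import Data.Nat.Properties as ℕ
open import Data.Nat.Coprimality using (1-coprimeTo) renaming (sym to coprime-sym)
open import Data.Nat.ListAction using (sum)
open import Data.Product using (Σ-syntax; ∃-syntax; _×_; _,_)
open import Data.Rational as ℚ using (mkℚ; *≤*)
import Data.Rational.Properties as ℚ
open import Data.Sum using (_⊎_; inj₁; inj₂)
open import Function using (_∘_; id)
open import Relation.Nullary using (¬_)
open import Relation.Binary.PropositionalEquality

module Geometry where
  open import Data.Integer using (_+_; _-_; _*_; _≤_)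
  open import Data.Integer.Tactic.RingSolver using (solve-∀)

  toℚ-mono-≤ : ∀ {x y} → x ≤ y → toℚ x ℚ.≤ toℚ y
  toℚ-mono-≤ {x} {y} x≤y = subst₂ ℚ._≤_ (sym (toℚ≡mkℚ x)) (sym (toℚ≡mkℚ y))
    (*≤* (subst₂ _≤_ (sym (ℤ.*-identityʳ x)) (sym (ℤ.*-identityʳ y)) x≤y))
    where
    toℚ≡mkℚ : ∀ z → toℚ z ≡ mkℚ z 0 (coprime-sym (1-coprimeTo _))
    toℚ≡mkℚ z = ℚ.↥p/↧p≡p (mkℚ z 0 (coprime-sym (1-coprimeTo _)))

  _∈ᶻ_ : ℤ × ℤ → Seg → Set
  (x , y) ∈ᶻ seg x₁ x₂ y₁ y₂ = (x₁ ≤ x × x ≤ x₂) × (y₁ ≤ y × y ≤ y₂)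

  Meet : Seg → Seg → Set
  Meet s t = Σ[ p ∈ ℤ × ℤ ] (p ∈ᶻ s × p ∈ᶻ t)

  Meet⇒¬Disjoint : ∀ {s t} → Meet s t → ¬ Disjoint s t
  Meet⇒¬Disjoint {s} {t} (p , p∈s , p∈t) disjoint =
    disjoint (toℚ² p , ∈ᶻ⇒∈ˢ s p∈s , ∈ᶻ⇒∈ˢ t p∈t)
    where
    toℚ² : ℤ × ℤ → Point
    toℚ² (x , y) = toℚ x , toℚ y
    ∈ᶻ⇒∈ˢ : ∀ s {p} → p ∈ᶻ s → toℚ² p ∈ˢ s
    ∈ᶻ⇒∈ˢ (seg _ _ _ _) ((x₁≤x , x≤x₂) , (y₁≤y , y≤y₂)) =
      (toℚ-mono-≤ x₁≤x , toℚ-mono-≤ x≤x₂) , (toℚ-mono-≤ y₁≤y , toℚ-mono-≤ y≤y₂)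

  -- (vx a b , vy a b) and (hx a b , hy a b) are the meeting points p and q of index b in the box
  -- with offset a; the box 𝓑ᵢ has offset 2ki.
  hx hy vx vy : ℤ → ℤ → ℤ
  hx a b = a + + 2 * b
  hy a b = a - + 2 * b
  vx a b = a + + 2 * b - + 1
  vy a b = a - + 2 * b + + 1

  offset : (k : ℕ) → Fin k → ℤ
  offset k i = + 2 * + k * idx i

  -- Gaps d below are written as sums of variables, so that + d unfolds to a sum of atoms and
  -- each required identity is a plain ring identity over ℤ.
  ≤-by-gap : ∀ {x y} d → x + + d ≡ y → x ≤ y
  ≤-by-gap {x} d refl = ℤ.i≤i+j x (+ d)

  vx≤hx : ∀ a b → vx a b ≤ hx a b
  vx≤hx a b = ≤-by-gap 1 (identity a b)
    where
    identity : ∀ a b → a + + 2 * b - + 1 + + 1 ≡ a + + 2 * b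
    identity = solve-∀

  hy≤vy : ∀ a b → hy a b ≤ vy a b
  hy≤vy a b = ≤-by-gap 1 refl

  hy≤vx : ∀ a n → hy a (+ suc n) ≤ vx a (+ suc n)
  hy≤vx a n = ≤-by-gap (n ℕ.+ n ℕ.+ n ℕ.+ n ℕ.+ 3) (identity a (+ n))
    where
    identity : ∀ a n → a - + 2 * (+ 1 + n) + (n + n + n + n + + 3) ≡ a + + 2 * (+ 1 + n) - + 1
    identity = solve-∀

  vy≤hx : ∀ a n → vy a (+ suc n) ≤ hx a (+ suc n)
  vy≤hx a n = ≤-by-gap (n ℕ.+ n ℕ.+ n ℕ.+ n ℕ.+ 3) (identity a (+ n))
    where
    identity : ∀ a n → a - + 2 * (+ 1 + n) + + 1 + (n + n + n + n + + 3) ≡ a + + 2 * (+ 1 + n)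
    identity = solve-∀

  vy≤hy-of-< : ∀ a {v u} → v ℕ.< u → vy a (+ u) ≤ hy a (+ v)
  vy≤hy-of-< a {v} v<u = let w , 1+v+w≡u = ℕ.m≤n⇒∃[o]m+o≡n v<u in
    subst (λ u → vy a (+ u) ≤ hy a (+ v)) 1+v+w≡u (≤-by-gap (w ℕ.+ w ℕ.+ 1) (identity a (+ v) (+ w)))
    where
    identity : ∀ a v w → a - + 2 * (+ 1 + (v + w)) + + 1 + (w + w + + 1) ≡ a - + 2 * v
    identity = solve-∀

  hx≤vx-of-< : ∀ a {v u} → v ℕ.< u → hx a (+ v) ≤ vx a (+ u)
  hx≤vx-of-< a {v} v<u = let w , 1+v+w≡u = ℕ.m≤n⇒∃[o]m+o≡n v<u in
    subst (λ u → hx a (+ v) ≤ vx a (+ u)) 1+v+w≡u (≤-by-gap (w ℕ.+ w ℕ.+ 1) (identity a (+ v) (+ w)))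
    where
    identity : ∀ a v w → a + + 2 * v + (w + w + + 1) ≡ a + + 2 * (+ 1 + (v + w)) - + 1
    identity = solve-∀

  pos-2*m*n : ∀ m n → + (2 ℕ.* m ℕ.* n) ≡ + 2 * + m * + n
  pos-2*m*n m n = trans (ℤ.pos-* (2 ℕ.* m) n) (cong (_* + n) (ℤ.pos-* 2 m))

  -1≤hy : ∀ k m {b} → b ℕ.≤ k → -[1+ 0 ] ≤ hy (+ 2 * + k * + suc m) (+ b)
  -1≤hy k m {b} b≤k = ℤ.≤-trans -≤+
    (subst₂ (λ x y → + 0 ≤ x - y) (pos-2*m*n k (suc m)) (ℤ.pos-* 2 b) (ℤ.i≤j⇒0≤j-i (+≤+ 2b≤2k[1+m])))
    where
    2b≤2k[1+m] : 2 ℕ.* b ℕ.≤ 2 ℕ.* k ℕ.* suc m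
    2b≤2k[1+m] = ℕ.≤-trans (ℕ.*-monoʳ-≤ 2 b≤k) (ℕ.m≤m*n (2 ℕ.* k) (suc m))

  hx≤N : ∀ {k a b} → a ℕ.≤ k → b ℕ.≤ k → hx (+ 2 * + k * + a) (+ b) ≤ bigN k
  hx≤N {k} {a} {b} a≤k b≤k =
    subst (_≤ bigN k) (cong₂ _+_ (pos-2*m*n k a) (ℤ.pos-* 2 b)) (+≤+ 2ka+2b≤N)
    where
    2k[k+1]≡2kk+2k : 2 ℕ.* k ℕ.* (k ℕ.+ 1) ≡ 2 ℕ.* k ℕ.* k ℕ.+ 2 ℕ.* k
    2k[k+1]≡2kk+2k = trans (ℕ.*-distribˡ-+ (2 ℕ.* k) k 1) (cong (2 ℕ.* k ℕ.* k ℕ.+_) (ℕ.*-identityʳ _))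
    2ka+2b≤N : 2 ℕ.* k ℕ.* a ℕ.+ 2 ℕ.* b ℕ.≤ 2 ℕ.* k ℕ.* (k ℕ.+ 1) ℕ.+ 1
    2ka+2b≤N = ℕ.≤-trans (ℕ.+-mono-≤ (ℕ.*-monoʳ-≤ (2 ℕ.* k) a≤k) (ℕ.*-monoʳ-≤ 2 b≤k))
      (ℕ.≤-trans (ℕ.≤-reflexive (sym 2k[k+1]≡2kk+2k)) (ℕ.m≤m+n _ 1))

  module Box (k : ℕ) (i : Fin k) where
    private
      a : ℤ
      a = offset k i

      -1≤hyⱼ : ∀ j → -[1+ 0 ] ≤ hy a (idx j)
      -1≤hyⱼ j = -1≤hy k (toℕ i) (toℕ<n j)

      hxⱼ≤N : ∀ j → hx a (idx j) ≤ bigN k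
      hxⱼ≤N j = hx≤N (toℕ<n i) (toℕ<n j)

      vxⱼ≤N : ∀ j → vx a (idx j) ≤ bigN k
      vxⱼ≤N j = ℤ.≤-trans (vx≤hx a (idx j)) (hxⱼ≤N j)

    up-meets-down : ∀ j → Meet (segment k (up , i , j)) (segment k (down , i , j))
    up-meets-down j = (vx a (idx j) , vy a (idx j)) ,
      ((ℤ.≤-refl , ℤ.≤-refl) , (ℤ.≤-refl , ℤ.≤-trans (vy≤hx a (toℕ j)) (hxⱼ≤N j))) ,
      ((ℤ.≤-refl , ℤ.≤-refl) , (ℤ.≤-trans (-1≤hyⱼ j) (hy≤vy a (idx j)) , ℤ.≤-refl))

    right-meets-left : ∀ j → Meet (segment k (right , i , j)) (segment k (left , i , j))
    right-meets-left j = (hx a (idx j) , hy a (idx j)) ,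
      ((ℤ.≤-refl , hxⱼ≤N j) , (ℤ.≤-refl , ℤ.≤-refl)) ,
      ((-1≤hxⱼ , ℤ.≤-refl) , (ℤ.≤-refl , ℤ.≤-refl))
      where
      -1≤hxⱼ : -[1+ 0 ] ≤ hx a (idx j)
      -1≤hxⱼ = ℤ.≤-trans (-1≤hyⱼ j) (ℤ.≤-trans (hy≤vx a (toℕ j)) (vx≤hx a (idx j)))

    down-meets-left : ∀ j → Meet (segment k (down , i , j)) (segment k (left , i , j))
    down-meets-left j = (vx a (idx j) , hy a (idx j)) ,
      ((ℤ.≤-refl , ℤ.≤-refl) , (-1≤hyⱼ j , hy≤vy a (idx j))) ,
      ((ℤ.≤-trans (-1≤hyⱼ j) (hy≤vx a (toℕ j)) , vx≤hx a (idx j)) , (ℤ.≤-refl , ℤ.≤-refl))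

    up-meets-right : ∀ {u v} → v <ᶠ u → Meet (segment k (up , i , u)) (segment k (right , i , v))
    up-meets-right {u} {v} v<u = (vx a (idx u) , hy a (idx v)) ,
      ((ℤ.≤-refl , ℤ.≤-refl) , (vy≤hy-of-< a (ℕ.s≤s v<u) , ℤ.≤-trans (hy≤vx a (toℕ v)) (vxⱼ≤N v))) ,
      ((hx≤vx-of-< a (ℕ.s≤s v<u) , vxⱼ≤N u) , (ℤ.≤-refl , ℤ.≤-refl))

open Geometry using (Meet; Meet⇒¬Disjoint; module Box)

open import Data.Nat using (_+_; _*_; _≤_; z≤n; s≤s)
open import Data.Nat.Properties
  using (≤-trans; m≤m+n; n≤1+n; +-mono-≤; +-identityʳ; +-comm; +-assoc; +-suc; module ≤-Reasoning)
open import Algebra.Properties.CommutativeSemigroup ℕ.+-commutativeSemigroup using (interchange)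

bit : Bool → ℕ
bit b = if b then 1 else 0

count : ∀ {n} → (Fin n → Bool) → ℕ
count a = sum (tabulate (bit ∘ a))

bit≤1 : ∀ b → bit b ≤ 1
bit≤1 true  = s≤s z≤n
bit≤1 false = z≤n

count≤ : ∀ {n} (a : Fin n → Bool) → count a ≤ n
count≤ {zero}  a = z≤n
count≤ {suc n} a = +-mono-≤ (bit≤1 (a zero)) (count≤ (a ∘ suc))

count≡0 : ∀ {n} (a : Fin n → Bool) → (∀ x → a x ≡ true → ⊥) → count a ≡ 0
count≡0 {zero}  a none = refl
count≡0 {suc n} a none with a zero in a₀
... | true  = ⊥-elim (none zero a₀)
... | false = count≡0 (a ∘ suc) (none ∘ suc)

count≡0⊎∃ : ∀ {n} (a : Fin n → Bool) → count a ≡ 0 ⊎ ∃[ x ] a x ≡ true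
count≡0⊎∃ {zero}  a = inj₁ refl
count≡0⊎∃ {suc n} a with a zero in a₀ | count≡0⊎∃ (a ∘ suc)
... | true  | _             = inj₂ (zero , a₀)
... | false | inj₁ a'≡0     = inj₁ a'≡0
... | false | inj₂ (x , ax) = inj₂ (suc x , ax)

count≡0⊎count≡0 : ∀ {n} (a b : Fin n → Bool) →
  ¬ ((∃[ x ] a x ≡ true) × (∃[ y ] b y ≡ true)) → count a ≡ 0 ⊎ count b ≡ 0
count≡0⊎count≡0 a b ¬both with count≡0⊎∃ a | count≡0⊎∃ b
... | inj₁ a≡0 | _        = inj₁ a≡0
... | inj₂ _   | inj₁ b≡0 = inj₂ b≡0
... | inj₂ x   | inj₂ y   = ⊥-elim (¬both (x , y))

count-exclusive : ∀ {n} (a b : Fin n → Bool) → (∀ x → a x ≡ true → b x ≡ true → ⊥) →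
  count a + count b ≤ n
count-exclusive {zero}  a b excl = z≤n
count-exclusive {suc n} a b excl = begin
  count a + count b
    ≡⟨ interchange (bit (a zero)) (count (a ∘ suc)) (bit (b zero)) (count (b ∘ suc)) ⟩
  (bit (a zero) + bit (b zero)) + (count (a ∘ suc) + count (b ∘ suc))
    ≤⟨ +-mono-≤ (bits-exclusive (a zero) (b zero) (excl zero))
                (count-exclusive (a ∘ suc) (b ∘ suc) (excl ∘ suc)) ⟩
  1 + n ∎
  where
  open ≤-Reasoning
  bits-exclusive : ∀ x y → (x ≡ true → y ≡ true → ⊥) → bit x + bit y ≤ 1
  bits-exclusive true  true  excl = ⊥-elim (excl refl refl)
  bits-exclusive true  false excl = s≤s z≤n
  bits-exclusive false y     excl = bit≤1 y

count-staircase : ∀ {n} (a b : Fin n → Bool) →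
  (∀ {x y} → y <ᶠ x → a x ≡ true → b y ≡ true → ⊥) → count a + count b ≤ suc n
count-staircase {zero}  a b stair = z≤n
count-staircase {suc n} a b stair
  with a zero in a₀ | b zero in b₀ | count-staircase (a ∘ suc) (b ∘ suc) (λ y<x → stair (s≤s y<x))
... | true  | true  | _ rewrite count≡0 (a ∘ suc) (λ x ax → stair (s≤s z≤n) ax b₀) =
  s≤s (s≤s (count≤ (b ∘ suc)))
... | true  | false | ih = s≤s ih
... | false | true  | ih rewrite +-suc (count (a ∘ suc)) (count (b ∘ suc)) = s≤s ih
... | false | false | ih = ≤-trans ih (n≤1+n _)

sum≤-of-surviving-pair : ∀ {u d r l n} → u + d ≤ n → r + l ≤ n → u + r ≤ suc n → d + l ≤ n →
  d ≡ 0 ⊎ r ≡ 0 → u ≡ 0 ⊎ l ≡ 0 → (u + d) + (r + l) ≤ n + 1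
sum≤-of-surviving-pair {n = n} _ r+l≤n _ _ (inj₁ refl) (inj₁ refl) = ≤-trans r+l≤n (m≤m+n n 1)
sum≤-of-surviving-pair {u} {r = r} {n = n} _ _ u+r≤1+n _ (inj₁ refl) (inj₂ refl)
  rewrite +-identityʳ u | +-identityʳ r | +-comm n 1 = u+r≤1+n
sum≤-of-surviving-pair {n = n} _ _ _ d+l≤n (inj₂ refl) (inj₁ refl) = ≤-trans d+l≤n (m≤m+n n 1)
sum≤-of-surviving-pair {u} {d} {n = n} u+d≤n _ _ _ (inj₂ refl) (inj₂ refl)
  rewrite +-identityʳ (u + d) = ≤-trans u+d≤n (m≤m+n n 1)

kindCount : ∀ {k} → SubsetM k → Fin k → Kind → ℕ
kindCount I i κ = count (λ j → I (κ , i , j))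

boxCount≡ : ∀ {k} (I : SubsetM k) i → boxCount k I i ≡
  (kindCount I i up + kindCount I i down) + (kindCount I i right + kindCount I i left)
boxCount≡ {k} I i = begin
  boxCount k I i
    ≡⟨ cong sum (map-cong (λ κ → cong sum (map-tabulate id (bit ∘ λ j → I (κ , i , j))))
                          (up ∷ down ∷ right ∷ left ∷ [])) ⟩
  c up + (c down + (c right + (c left + 0)))
    ≡⟨ cong (λ x → c up + (c down + (c right + x))) (+-identityʳ (c left)) ⟩
  c up + (c down + (c right + c left))
    ≡⟨ sym (+-assoc (c up) (c down) _) ⟩
  (c up + c down) + (c right + c left) ∎
  where
  open ≡-Reasoning
  c : Kind → ℕ
  c = kindCount I i

module _ {k} {I : SubsetM k} (disjoint : PairwiseDisjoint k I) (i : Fin k) where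
  open Box k i

  private
    exclusive : ∀ {l l'} → l ≢ l' → Meet (segment k l) (segment k l') → I l ≡ true → I l' ≡ true → ⊥
    exclusive l≢l' meet Il Il' = Meet⇒¬Disjoint meet (disjoint _ _ Il Il' l≢l')

  up+down≤k : kindCount I i up + kindCount I i down ≤ k
  up+down≤k = count-exclusive _ _ λ j → exclusive (λ ()) (up-meets-down j)

  right+left≤k : kindCount I i right + kindCount I i left ≤ k
  right+left≤k = count-exclusive _ _ λ j → exclusive (λ ()) (right-meets-left j)

  down+left≤k : kindCount I i down + kindCount I i left ≤ k
  down+left≤k = count-exclusive _ _ λ j → exclusive (λ ()) (down-meets-left j)

  up+right≤1+k : kindCount I i up + kindCount I i right ≤ suc k
  up+right≤1+k = count-staircase _ _ λ v<u → exclusive (λ ()) (up-meets-right v<u)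

lemma11 : (k : ℕ) → 1 ≤ k → (I : SubsetM k) → PairwiseDisjoint k I →
    (i : Fin k) → boxCount k I i ≤ 2 * k × (Boring k I i → boxCount k I i ≤ k + 1)
lemma11 k _ I disjoint i rewrite boxCount≡ I i =
    +-mono-≤ (up+down≤k disjoint i) (subst (R + L ≤_) (sym (+-identityʳ k)) (right+left≤k disjoint i))
  , λ boring → sum≤-of-surviving-pair
      (up+down≤k disjoint i) (right+left≤k disjoint i) (up+right≤1+k disjoint i) (down+left≤k disjoint i)
      (count≡0⊎count≡0 _ _ (boring ∘ inj₁)) (count≡0⊎count≡0 _ _ (boring ∘ inj₂))
  where
  R L : ℕ
  R = kindCount I i right
  L = kindCount I i left
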